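{- Let $(L,\vee,\wedge,{}^*,0,1)$ be a Stone lattice, define $x\rightarrow y:=x^*\vee y$ and $x\Rightarrow y:=x^*\vee y^{**}$ for $x,y\in L$, and let $a,b,c\in L$. Then: (i) $(a\Rightarrow b)\Rightarrow b=a^{**}\vee b^{**}=(b\Rightarrow a)\Rightarrow a$; (ii) $a\wedge b^*\le c^{**}$ if and only if $a\le b^*\Rightarrow c$; (iii) $a\rightarrow b=a\Rightarrow b$ if and only if $a^{**}\wedge b=a^{**}\wedge b^{**}$; (iv) $a\Rightarrow(b\Rightarrow c)=(a\Rightarrow c)\vee(b\Rightarrow c)=b\Rightarrow(a\Rightarrow c)$; (v) $(a\Rightarrow b^*)\vee c^*=a\Rightarrow(b^*\vee c^*)=(a\Rightarrow c^*)\vee b^*$; (vi) $a\Rightarrow b=1$ if and only if $a\le b^{**}$.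
   Context: A bounded lattice $(L,\vee,\wedge,0,1)$ is pseudocomplemented if for each $a\in L$ there is a greatest element $a^*\in L$ with $a\wedge a^*=0$; $a^*$ is the pseudocomplement of $a$. A Stone lattice is a distributive pseudocomplemented lattice satisfying the Stone identity $x^*\vee x^{**}=1$ for all $x$. -}

module Defs where

open import Level using (suc; _⊔_)
open import Algebra.Lattice.Bundles using (DistributiveLattice)

record StoneLattice c ℓ : Set (suc (c ⊔ ℓ)) where
  field
    distributiveLattice : DistributiveLattice c ℓ
  open DistributiveLattice distributiveLattice public

  infix 4 _≤_
  _≤_ : Carrier → Carrier → Set ℓ
  x ≤ y = (x ∧ y) ≈ x

  infix 8 _*
  field
    𝟘 𝟙        : Carrier
    𝟘-least    : ∀ x → 𝟘 ≤ x
    𝟙-greatest : ∀ x → x ≤ 𝟙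
    _*         : Carrier → Carrier
    *-disjoint : ∀ x → (x ∧ (x *)) ≈ 𝟘
    *-greatest : ∀ x y → (x ∧ y) ≈ 𝟘 → y ≤ x *
    stone      : ∀ x → ((x *) ∨ ((x *) *)) ≈ 𝟙

  infixr 5 _⟶_ _⟹_
  _⟶_ : Carrier → Carrier → Carrier
  x ⟶ y = (x *) ∨ y

  _⟹_ : Carrier → Carrier → Carrier
  x ⟹ y = (x *) ∨ ((y *) *)

-- In a Stone lattice each pseudocomplement x* is complemented, with complement x**.
-- Hence (x ∧ y)* = x* ∨ y*, joins of pseudocomplements are regular, and in particular
-- x ⇒ y = x* ∨ y** is regular. Every item then reduces to Boolean reasoning with a
-- complemented pair (u, v): the cancellations u ∧ (v ∨ x) = u ∧ x and
-- v ∨ (u ∧ x) = v ∨ x, and the shunting rule a ∧ u ≤ c ⇔ a ≤ v ∨ c.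
module Submission where

open import Defs
open import Level using (Level)
open import Data.Product using (_×_; _,_)
open import Function.Bundles using (_⇔_; mk⇔; Equivalence)
open import Algebra.Bundles using (CommutativeSemigroup)
open import Algebra.Structures using (module IsCommutativeBand)
open import Relation.Binary.Lattice.Structures using (IsLattice)
open import Relation.Binary.Lattice.Bundles using (Lattice)
import Algebra.Lattice.Properties.Lattice as AlgebraicLatticeProperties
import Algebra.Properties.CommutativeSemigroup as CommutativeSemigroupProperties
import Relation.Binary.Lattice.Properties.JoinSemilattice as JoinSemilatticeProperties
import Relation.Binary.Lattice.Properties.MeetSemilattice as MeetSemilatticeProperties
import Relation.Binary.Reasoning.PartialOrder as PosetReasoning

module StoneLatticeProperties {c ℓ} (L : StoneLattice c ℓ) where
  open StoneLattice L
  open AlgebraicLatticeProperties lattice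
    using (∧-isSemilattice; ∨-∧-orderTheoreticLattice)

  -- Defs orders by x ∧ y ≈ x, the library by x ≈ x ∧ y; transport along sym.
  private module ⊑ = Lattice ∨-∧-orderTheoreticLattice

  ≤-isLattice : IsLattice _≈_ _≤_ _∨_ _∧_
  ≤-isLattice = record
    { isPartialOrder = record
      { isPreorder = record
        { isEquivalence = isEquivalence
        ; reflexive     = λ x≈y → sym (⊑.reflexive x≈y)
        ; trans         = λ x≤y y≤z → sym (⊑.trans (sym x≤y) (sym y≤z))
        }
      ; antisym = λ x≤y y≤x → ⊑.antisym (sym x≤y) (sym y≤x)
      }
    ; supremum = λ x y → sym (⊑.x≤x∨y x y) , sym (⊑.y≤x∨y x y)
                       , λ z x≤z y≤z → sym (⊑.∨-least (sym x≤z) (sym y≤z))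
    ; infimum  = λ x y → sym (⊑.x∧y≤x x y) , sym (⊑.x∧y≤y x y)
                       , λ z z≤x z≤y → sym (⊑.∧-greatest (sym z≤x) (sym z≤y))
    }

  ≤-lattice : Lattice c ℓ ℓ
  ≤-lattice = record { isLattice = ≤-isLattice }

  open Lattice ≤-lattice
    using (x≤x∨y; y≤x∨y; ∨-least; x∧y≤x; x∧y≤y; ∧-greatest)
    renaming (refl to ≤-refl; trans to ≤-trans; antisym to ≤-antisym; reflexive to ≤-reflexive)
  open JoinSemilatticeProperties (Lattice.joinSemilattice ≤-lattice)
    using (∨-monotonic; x≤y⇒x∨y≈y)
  open MeetSemilatticeProperties (Lattice.meetSemilattice ≤-lattice)
    using (∧-monotonic)
  open PosetReasoning (Lattice.poset ≤-lattice)

  private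
    ∧-commutativeSemigroup : CommutativeSemigroup c ℓ
    ∧-commutativeSemigroup = record
      { isCommutativeSemigroup = IsCommutativeBand.isCommutativeSemigroup ∧-isSemilattice }
    module ∧-CS = CommutativeSemigroupProperties ∧-commutativeSemigroup

  ∨-identityˡ : ∀ x → 𝟘 ∨ x ≈ x
  ∨-identityˡ x = x≤y⇒x∨y≈y (𝟘-least x)

  x≤𝟘⇒x≈𝟘 : ∀ {x} → x ≤ 𝟘 → x ≈ 𝟘
  x≤𝟘⇒x≈𝟘 {x} x≤𝟘 = ≤-antisym x≤𝟘 (𝟘-least x)

  𝟙≤x⇒x≈𝟙 : ∀ {x} → 𝟙 ≤ x → x ≈ 𝟙
  𝟙≤x⇒x≈𝟙 {x} 𝟙≤x = ≤-antisym (𝟙-greatest x) 𝟙≤x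

  IsComplement : Carrier → Carrier → Set ℓ
  IsComplement u v = (u ∧ v ≈ 𝟘) × (u ∨ v ≈ 𝟙)

  IsComplement-sym : ∀ {u v} → IsComplement u v → IsComplement v u
  IsComplement-sym (disjoint , covering) =
    trans (∧-comm _ _) disjoint , trans (∨-comm _ _) covering

  complement-∧-cancel : ∀ {u v} → IsComplement u v → ∀ x → u ∧ (v ∨ x) ≈ u ∧ x
  complement-∧-cancel {u} {v} (disjoint , _) x = begin-equality
    u ∧ (v ∨ x)        ≈⟨ ∧-distribˡ-∨ u v x ⟩
    (u ∧ v) ∨ (u ∧ x)  ≈⟨ ∨-congʳ disjoint ⟩
    𝟘 ∨ (u ∧ x)        ≈⟨ ∨-identityˡ (u ∧ x) ⟩
    u ∧ x              ∎

  complement-∨-cancel : ∀ {u v} → IsComplement u v → ∀ x → v ∨ (u ∧ x) ≈ v ∨ x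
  complement-∨-cancel {u} {v} (_ , covering) x = begin-equality
    v ∨ (u ∧ x)        ≈⟨ ∨-distribˡ-∧ v u x ⟩
    (v ∨ u) ∧ (v ∨ x)  ≈⟨ ∧-congʳ (trans (∨-comm v u) covering) ⟩
    𝟙 ∧ (v ∨ x)        ≈⟨ ∧-comm 𝟙 (v ∨ x) ⟩
    (v ∨ x) ∧ 𝟙        ≈⟨ 𝟙-greatest (v ∨ x) ⟩
    v ∨ x              ∎

  complement-cancel : ∀ {u v} → IsComplement u v →
                      ∀ {x y} → (v ∨ x ≈ v ∨ y ⇔ u ∧ x ≈ u ∧ y)
  complement-cancel {u} {v} uv {x} {y} = mk⇔ to from
    where
    to : v ∨ x ≈ v ∨ y → u ∧ x ≈ u ∧ y
    to e = begin-equality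
      u ∧ x        ≈⟨ sym (complement-∧-cancel uv x) ⟩
      u ∧ (v ∨ x)  ≈⟨ ∧-congˡ e ⟩
      u ∧ (v ∨ y)  ≈⟨ complement-∧-cancel uv y ⟩
      u ∧ y        ∎
    from : u ∧ x ≈ u ∧ y → v ∨ x ≈ v ∨ y
    from e = begin-equality
      v ∨ x        ≈⟨ sym (complement-∨-cancel uv x) ⟩
      v ∨ (u ∧ x)  ≈⟨ ∨-congˡ e ⟩
      v ∨ (u ∧ y)  ≈⟨ complement-∨-cancel uv y ⟩
      v ∨ y        ∎

  complement-shunting : ∀ {u v} → IsComplement u v →
                        ∀ {a c} → (a ∧ u ≤ c ⇔ a ≤ v ∨ c)
  complement-shunting {u} {v} uv@(_ , covering) {a} {c} = mk⇔ to from
    where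
    to : a ∧ u ≤ c → a ≤ v ∨ c
    to a∧u≤c = begin
      a                  ≈⟨ sym (𝟙-greatest a) ⟩
      a ∧ 𝟙              ≈⟨ ∧-congˡ (sym covering) ⟩
      a ∧ (u ∨ v)        ≈⟨ ∧-distribˡ-∨ a u v ⟩
      (a ∧ u) ∨ (a ∧ v)  ≤⟨ ∨-monotonic a∧u≤c (x∧y≤y a v) ⟩
      c ∨ v              ≈⟨ ∨-comm c v ⟩
      v ∨ c              ∎
    from : a ≤ v ∨ c → a ∧ u ≤ c
    from a≤v∨c = begin
      a ∧ u        ≤⟨ ∧-monotonic a≤v∨c ≤-refl ⟩
      (v ∨ c) ∧ u  ≈⟨ ∧-comm (v ∨ c) u ⟩
      u ∧ (v ∨ c)  ≈⟨ complement-∧-cancel uv c ⟩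
      u ∧ c        ≤⟨ x∧y≤y u c ⟩
      c            ∎

  ≤*⇒∧≈𝟘 : ∀ {x y} → y ≤ x * → x ∧ y ≈ 𝟘
  ≤*⇒∧≈𝟘 {x} {y} y≤x* = x≤𝟘⇒x≈𝟘 (begin
    x ∧ y    ≤⟨ ∧-monotonic ≤-refl y≤x* ⟩
    x ∧ x *  ≈⟨ *-disjoint x ⟩
    𝟘        ∎)

  x≤x** : ∀ x → x ≤ x * *
  x≤x** x = *-greatest (x *) x (trans (∧-comm (x *) x) (*-disjoint x))

  *-antitone : ∀ {x y} → x ≤ y → y * ≤ x *
  *-antitone {x} {y} x≤y =
    *-greatest x (y *) (trans (∧-comm x (y *)) (≤*⇒∧≈𝟘 (≤-trans x≤y (x≤x** y))))

  ***≈* : ∀ x → x * * * ≈ x *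
  ***≈* x = ≤-antisym (*-antitone (x≤x** x)) (x≤x** (x *))

  *-cong : ∀ {x y} → x ≈ y → x * ≈ y *
  *-cong x≈y = ≤-antisym (*-antitone (≤-reflexive (sym x≈y))) (*-antitone (≤-reflexive x≈y))

  **-disjointˡ : ∀ {x z} → x ∧ z ≈ 𝟘 → x * * ∧ z ≈ 𝟘
  **-disjointˡ {x} {z} x∧z≈𝟘 =
    ≤*⇒∧≈𝟘 (≤-trans (*-greatest x z x∧z≈𝟘) (≤-reflexive (sym (***≈* x))))

  *-complement : ∀ x → IsComplement (x *) (x * *)
  *-complement x = *-disjoint (x *) , stone x

  deMorgan₂ : ∀ x y → (x ∨ y) * ≈ x * ∧ y *
  deMorgan₂ x y = ≤-antisym
    (∧-greatest (*-antitone (x≤x∨y x y)) (*-antitone (y≤x∨y x y)))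
    (*-greatest (x ∨ y) (x * ∧ y *) disjoint)
    where
    disjoint : (x ∨ y) ∧ (x * ∧ y *) ≈ 𝟘
    disjoint = begin-equality
      (x ∨ y) ∧ (x * ∧ y *)                  ≈⟨ ∧-distribʳ-∨ (x * ∧ y *) x y ⟩
      (x ∧ (x * ∧ y *)) ∨ (y ∧ (x * ∧ y *))  ≈⟨ ∨-cong (≤*⇒∧≈𝟘 (x∧y≤x (x *) (y *)))
                                                        (≤*⇒∧≈𝟘 (x∧y≤y (x *) (y *))) ⟩
      𝟘 ∨ 𝟘                                  ≈⟨ ∨-identityˡ 𝟘 ⟩
      𝟘                                      ∎

  -- Unlike deMorgan₂, this law needs the Stone identity (it is in fact equivalent to it).
  deMorgan₁ : ∀ x y → (x ∧ y) * ≈ x * ∨ y *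
  deMorgan₁ x y = ≤-antisym
    (Equivalence.to (complement-shunting (IsComplement-sym (*-complement x)))
                    (*-greatest y (w ∧ x * *) y-disjoint))
    (∨-least (*-antitone (x∧y≤x x y)) (*-antitone (x∧y≤y x y)))
    where
    w : Carrier
    w = (x ∧ y) *
    x-disjoint : x ∧ (w ∧ y) ≈ 𝟘
    x-disjoint = trans (sym (∧-CS.xy∙z≈x∙zy x y w)) (*-disjoint (x ∧ y))
    y-disjoint : y ∧ (w ∧ x * *) ≈ 𝟘
    y-disjoint = trans (sym (∧-CS.x∙yz≈z∙yx (x * *) w y)) (**-disjointˡ x-disjoint)

  *∨*-regular : ∀ x y → (x * ∨ y *) * * ≈ x * ∨ y *
  *∨*-regular x y = begin-equality
    (x * ∨ y *) * *     ≈⟨ *-cong (deMorgan₂ (x *) (y *)) ⟩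
    (x * * ∧ y * *) *   ≈⟨ deMorgan₁ (x * *) (y * *) ⟩
    x * * * ∨ y * * *   ≈⟨ ∨-cong (***≈* x) (***≈* y) ⟩
    x * ∨ y *           ∎

  [x⟹y]⟹y≈x**∨y** : ∀ x y → (x ⟹ y) ⟹ y ≈ x * * ∨ y * *
  [x⟹y]⟹y≈x**∨y** x y = begin-equality
    (x * ∨ y * *) * ∨ y * *    ≈⟨ ∨-congʳ (deMorgan₂ (x *) (y * *)) ⟩
    (x * * ∧ y * * *) ∨ y * *  ≈⟨ ∨-congʳ (∧-congˡ (***≈* y)) ⟩
    (x * * ∧ y *) ∨ y * *      ≈⟨ ∨-comm (x * * ∧ y *) (y * *) ⟩
    y * * ∨ (x * * ∧ y *)      ≈⟨ ∨-congˡ (∧-comm (x * *) (y *)) ⟩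
    y * * ∨ (y * ∧ x * *)      ≈⟨ complement-∨-cancel (*-complement y) (x * *) ⟩
    y * * ∨ x * *              ≈⟨ ∨-comm (y * *) (x * *) ⟩
    x * * ∨ y * *              ∎

  x⟹[y⟹z]≈[x⟹z]∨[y⟹z] : ∀ x y z → x ⟹ (y ⟹ z) ≈ (x ⟹ z) ∨ (y ⟹ z)
  x⟹[y⟹z]≈[x⟹z]∨[y⟹z] x y z = begin-equality
    x * ∨ (y * ∨ z * *) * *        ≈⟨ ∨-congˡ (*∨*-regular y (z *)) ⟩
    x * ∨ (y * ∨ z * *)            ≈⟨ ∨-congˡ (sym (x≤y⇒x∨y≈y (y≤x∨y (y *) (z * *)))) ⟩
    x * ∨ (z * * ∨ (y * ∨ z * *))  ≈⟨ sym (∨-assoc (x *) (z * *) (y * ∨ z * *)) ⟩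
    (x * ∨ z * *) ∨ (y * ∨ z * *)  ∎

  x⟹[y*∨z*]≈[x⟹y*]∨z* : ∀ x y z → x ⟹ (y * ∨ z *) ≈ (x ⟹ y *) ∨ z *
  x⟹[y*∨z*]≈[x⟹y*]∨z* x y z = begin-equality
    x * ∨ (y * ∨ z *) * *  ≈⟨ ∨-congˡ (*∨*-regular y z) ⟩
    x * ∨ (y * ∨ z *)      ≈⟨ sym (∨-assoc (x *) (y *) (z *)) ⟩
    (x * ∨ y *) ∨ z *      ≈⟨ ∨-congʳ (∨-congˡ (sym (***≈* y))) ⟩
    (x * ∨ y * * *) ∨ z *  ∎

  x⟹y≈𝟙⇔x≤y** : ∀ x y → (x ⟹ y ≈ 𝟙 ⇔ x ≤ y * *)
  x⟹y≈𝟙⇔x≤y** x y = mk⇔ to from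
    where
    to : x ⟹ y ≈ 𝟙 → x ≤ y * *
    to x⟹y≈𝟙 = begin
      x                      ≤⟨ x≤x** x ⟩
      x * *                  ≈⟨ sym (𝟙-greatest (x * *)) ⟩
      x * * ∧ 𝟙              ≈⟨ ∧-congˡ (sym x⟹y≈𝟙) ⟩
      x * * ∧ (x * ∨ y * *)  ≈⟨ complement-∧-cancel (IsComplement-sym (*-complement x)) (y * *) ⟩
      x * * ∧ y * *          ≤⟨ x∧y≤y (x * *) (y * *) ⟩
      y * *                  ∎
    from : x ≤ y * * → x ⟹ y ≈ 𝟙
    from x≤y** = 𝟙≤x⇒x≈𝟙 (begin
      𝟙              ≈⟨ sym (stone x) ⟩
      x * ∨ x * *    ≤⟨ ∨-monotonic ≤-refl x**≤y** ⟩
      x * ∨ y * *    ∎)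
      where
      x**≤y** : x * * ≤ y * *
      x**≤y** = ≤-trans (*-antitone (*-antitone x≤y**)) (≤-reflexive (***≈* (y *)))

theorem4p6 : ∀ {ℓ₁ ℓ₂ : Level} (L : StoneLattice ℓ₁ ℓ₂) → let open StoneLattice L in
    ∀ (a b c : Carrier) →
      (((a ⟹ b) ⟹ b) ≈ ((a *) *) ∨ ((b *) *) × ((a *) *) ∨ ((b *) *) ≈ ((b ⟹ a) ⟹ a))
      × (a ∧ (b *) ≤ (c *) * ⇔ a ≤ ((b *) ⟹ c))
      × ((a ⟶ b) ≈ (a ⟹ b) ⇔ ((a *) *) ∧ b ≈ ((a *) *) ∧ ((b *) *))
      × ((a ⟹ (b ⟹ c)) ≈ (a ⟹ c) ∨ (b ⟹ c) × (a ⟹ c) ∨ (b ⟹ c) ≈ (b ⟹ (a ⟹ c)))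
      × ((a ⟹ (b *)) ∨ (c *) ≈ (a ⟹ ((b *) ∨ (c *))) × (a ⟹ ((b *) ∨ (c *))) ≈ (a ⟹ (c *)) ∨ (b *))
      × ((a ⟹ b) ≈ 𝟙 ⇔ a ≤ (b *) *)
theorem4p6 L a b c =
    ( [x⟹y]⟹y≈x**∨y** a b
    , trans (∨-comm (a * *) (b * *)) (sym ([x⟹y]⟹y≈x**∨y** b a)) )
  , complement-shunting (*-complement b)
  , complement-cancel (IsComplement-sym (*-complement a))
  , ( x⟹[y⟹z]≈[x⟹z]∨[y⟹z] a b c
    , trans (∨-comm (a ⟹ c) (b ⟹ c)) (sym (x⟹[y⟹z]≈[x⟹z]∨[y⟹z] b a c)) )
  , ( sym (x⟹[y*∨z*]≈[x⟹y*]∨z* a b c)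
    , trans (∨-congˡ (*-cong (*-cong (∨-comm (b *) (c *))))) (x⟹[y*∨z*]≈[x⟹y*]∨z* a c b) )
  , x⟹y≈𝟙⇔x≤y** a b
  where
  open StoneLattice L
  open StoneLatticeProperties L
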